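{- Let $k,\Delta_A,\Delta_B$ be positive integers with $\Delta_B \geq k$ and $\Delta_B \log \Delta_A > 1.4k^2$. Then $K_{\Delta_B,\Delta_A}$ is not $(2,k)$-choosable.
   Context: All graphs are finite and simple. For a bipartite graph $G$ with bipartition $V = A \sqcup B$ and positive integers $k_A, k_B$, $G$ is $(k_A,k_B)$-choosable if for every set of colors $C$ and every list assignment $L$ assigning to each vertex of $A$ a $k_A$-element subset of $C$ and to each vertex of $B$ a $k_B$-element subset of $C$, there is a map $c\colon V\to C$ with $c(v)\in L(v)$ for all $v$ and $c(v)\neq c(v')$ for every edge $vv'$. For the complete bipartite graph $K_{\Delta_B,\Delta_A}$ the part $A$ has $\Delta_B$ vertices and the part $B$ has $\Delta_A$ vertices. $\log$ is the natural logarithm. -}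

module Defs where

open import Data.Nat as ℕ using (ℕ; zero; suc)
open import Data.Integer as ℤ using (ℤ; +_)
open import Data.Rational as ℚ using (ℚ; _/_; _<_; _+_; _*_; 0ℚ; 1ℚ)
open import Data.Fin using (Fin)
open import Data.Product using (Σ; ∃; _×_)
open import Relation.Binary.PropositionalEquality using (_≡_; _≢_)
open import Function.Definitions using (Injective)

-- Natural logarithm, defined by its (monotone, convergent) series
--   log x = 2 Σ_{j ≥ 0} y^(2j+1) / (2j+1),   y = (x-1)/(x+1),  x ≥ 1.
-- For x ≥ 1 the partial sums are nondecreasing with limit log x, so for a
-- rational c:  log x > c  iff  some partial sum exceeds c.

_^ℚ_ : ℚ → ℕ → ℚ
q ^ℚ zero  = 1ℚ
q ^ℚ suc n = q * (q ^ℚ n)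

logY : ℕ → ℚ
logY x = (+ x ℤ.- ℤ.+ 1) / suc x

logPartial : ℕ → ℕ → ℚ
logPartial x zero    = 0ℚ
logPartial x (suc n) =
  logPartial x n + ((+ 2) / suc (2 ℕ.* n)) * (logY x ^ℚ suc (2 ℕ.* n))

_<_·log_ : ℚ → ℕ → ℕ → Set
c < d ·log x = ∃ λ n → c < ((+ d) / 1) * logPartial x n

-- A list assignment giving each vertex a k-element subset of C is
-- represented as an injective map Fin k → C per vertex (its image is the
-- list); a choice of colour c(v) ∈ L(v) is an index into that map.

Choosable : (m n : ℕ) (E : Fin m → Fin n → Set) (kA kB : ℕ) → Set₁
Choosable m n E kA kB =
  (C : Set) (LA : Fin m → Fin kA → C) (LB : Fin n → Fin kB → C) →
  (∀ a → Injective _≡_ _≡_ (LA a)) →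
  (∀ b → Injective _≡_ _≡_ (LB b)) →
  Σ (Fin m → Fin kA) λ cA → Σ (Fin n → Fin kB) λ cB →
    ∀ a b → E a b → LA a (cA a) ≢ LB b (cB b)

Kcomplete : (ΔB ΔA : ℕ) → Fin ΔB → Fin ΔA → Set
Kcomplete ΔB ΔA a b = ⊤'
  where open import Data.Unit using () renaming (⊤ to ⊤')

module Submission where

-- Split the k positions of a list into m blocks, r of size q + 1 and h = m − r of size q, and give
-- every cell (b , u) of a block two colours, one per side 0F and 1F.  Each of the 2^m vertices of B
-- takes, in every block, all cells of one side; for every block b and every pair (u , v) of cells
-- of b some vertex of A gets the list {((b , u) , 0F) , ((b , v) , 1F)}.  The vertex of B that takes exactly the used-up
-- sides then has no colour left.
--
-- This needs 2^m ≤ ΔA and Σ (block size)² ≤ ΔB.  With m = ⌊log₂ ΔA⌋ < k the sum is at most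
-- k²/m + m/4, and the hypothesis ΔB log ΔA > 1.4 k² makes it at most ΔB because log ΔA ≤ m + 0.51
-- (log ΔA ≤ 1.2 when m = 1).  These bounds on log come from the series
-- log x = 2 Σ y^(2j+1)/(2j+1), y = (x − 1)/(x + 1), whose partial sums grow by at most
-- (z − x)(z + 1)/(z (x + 1)) from x to z, hence by at most 1 under doubling.  When k ≤ ⌊log₂ ΔA⌋
-- blocks of size 1 suffice.

module Fraction where

  open import Data.Nat as ℕ using (ℕ; suc)
  open import Data.Nat.Properties using (+-identityʳ)
  open import Data.Nat.Tactic.RingSolver using (solve-∀)
  open import Data.Integer as ℤ using (+_)
  open import Data.Integer.Properties using (+◃n≡+n; pos-+)
  open import Data.Rational using (ℚ; _/_; _≤_; _+_; _*_; 0ℚ; 1ℚ; toℚᵘ)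
  open import Data.Rational.Properties using (toℚᵘ-fromℚᵘ; fromℚᵘ-cong; toℚᵘ-cancel-≤; toℚᵘ-injective; toℚᵘ-homo-+; toℚᵘ-homo-*)
  open import Data.Rational.Unnormalised using (mkℚᵘ; _≃_; *≡*; *≤*)
  import Data.Rational.Unnormalised.Properties as ℚᵘ
  open import Relation.Binary.PropositionalEquality using (_≡_; refl; sym; trans; cong; cong₂; subst₂)

  -- suc (d ⊗ e) reduces to suc d * suc e, the denominator of sums and products in ℚᵘ.
  _⊗_ : ℕ → ℕ → ℕ
  d ⊗ e = e ℕ.+ d ℕ.* suc e

  -- Opaque, since unfolded into normalize and gcd it defeats inference of a and d.
  opaque
    frac : ℕ → ℕ → ℚ
    frac a d = + a / suc d

  opaque
    unfolding frac

    private
      +*+ : ∀ a b → + a ℤ.* + b ≡ + (a ℕ.* b)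
      +*+ a b = +◃n≡+n (a ℕ.* b)

      toℚᵘ-frac : ∀ a d → toℚᵘ (frac a d) ≃ mkℚᵘ (+ a) d
      toℚᵘ-frac a d = toℚᵘ-fromℚᵘ (mkℚᵘ (+ a) d)

    +/suc≡frac : ∀ a d → + a / suc d ≡ frac a d
    +/suc≡frac a d = refl

    frac-1 : frac 1 0 ≡ 1ℚ
    frac-1 = refl

    frac-cong : ∀ {a d b e} → a ℕ.* suc e ≡ b ℕ.* suc d → frac a d ≡ frac b e
    frac-cong {a} {d} {b} {e} eq = fromℚᵘ-cong {mkℚᵘ (+ a) d} {mkℚᵘ (+ b) e}
      (*≡* (trans (+*+ a (suc e)) (trans (cong +_ eq) (sym (+*+ b (suc d))))))

    frac-mono-≤ : ∀ {a d b e} → a ℕ.* suc e ℕ.≤ b ℕ.* suc d → frac a d ≤ frac b e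
    frac-mono-≤ {a} {d} {b} {e} le = toℚᵘ-cancel-≤
      (ℚᵘ.≤-respˡ-≃ (ℚᵘ.≃-sym (toℚᵘ-frac a d)) (ℚᵘ.≤-respʳ-≃ (ℚᵘ.≃-sym (toℚᵘ-frac b e))
        (*≤* (subst₂ ℤ._≤_ (sym (+*+ a (suc e))) (sym (+*+ b (suc d))) (ℤ.+≤+ le)))))

    frac-nonNeg : ∀ a d → 0ℚ ≤ frac a d
    frac-nonNeg a d = frac-mono-≤ {0} {0} {a} {d} ℕ.z≤n

    frac-0 : ∀ d → frac 0 d ≡ 0ℚ
    frac-0 d = frac-cong {0} {d} {0} {0} refl

    frac-+ : ∀ a d b e → frac a d + frac b e ≡ frac (a ℕ.* suc e ℕ.+ b ℕ.* suc d) (d ⊗ e)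
    frac-+ a d b e = toℚᵘ-injective (ℚᵘ.≃-trans (toℚᵘ-homo-+ (frac a d) (frac b e))
      (ℚᵘ.≃-trans (ℚᵘ.+-cong (toℚᵘ-frac a d) (toℚᵘ-frac b e))
      (ℚᵘ.≃-trans (ℚᵘ.≃-reflexive (cong (λ n → mkℚᵘ n (d ⊗ e)) numerator)) (ℚᵘ.≃-sym (toℚᵘ-frac _ _)))))
      where
      numerator : + a ℤ.* + suc e ℤ.+ + b ℤ.* + suc d ≡ + (a ℕ.* suc e ℕ.+ b ℕ.* suc d)
      numerator = trans (cong₂ ℤ._+_ (+*+ a (suc e)) (+*+ b (suc d))) (sym (pos-+ (a ℕ.* suc e) (b ℕ.* suc d)))

    frac-* : ∀ a d b e → frac a d * frac b e ≡ frac (a ℕ.* b) (d ⊗ e)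
    frac-* a d b e = toℚᵘ-injective (ℚᵘ.≃-trans (toℚᵘ-homo-* (frac a d) (frac b e))
      (ℚᵘ.≃-trans (ℚᵘ.*-cong (toℚᵘ-frac a d) (toℚᵘ-frac b e))
      (ℚᵘ.≃-trans (ℚᵘ.≃-reflexive (cong (λ n → mkℚᵘ n (d ⊗ e)) (+*+ a b))) (ℚᵘ.≃-sym (toℚᵘ-frac _ _)))))

  frac-suc : ∀ n → frac (suc n) 0 ≡ frac n 0 + 1ℚ
  frac-suc n = sym (trans (cong (λ x → frac n 0 + x) (sym frac-1)) (trans (frac-+ n 0 1 0) (frac-cong (cross n))))
    where
    cross : ∀ n → (n ℕ.* 1 ℕ.+ 1 ℕ.* 1) ℕ.* 1 ≡ suc n ℕ.* suc (0 ⊗ 0)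
    cross = solve-∀

  frac-*ˡ : ∀ a b d → frac a 0 * frac b d ≡ frac (a ℕ.* b) d
  frac-*ˡ a b d = trans (frac-* a 0 b d) (frac-cong (cong (λ x → a ℕ.* b ℕ.* x) (cong suc (sym (+-identityʳ d)))))

module Series where

  open Fraction
  open import Defs using (_^ℚ_)
  open import Data.Nat as ℕ using (ℕ; zero; suc)
  open import Data.Nat.Properties using (*-suc)
  open import Data.Nat.Tactic.RingSolver using (solve-∀)
  open import Data.Rational using (ℚ; _≤_; _+_; _*_; 0ℚ; 1ℚ; nonNegative)
  open import Data.Rational.Properties using (≤-refl; ≤-trans; ≤-reflexive; +-mono-≤; +-monoˡ-≤; +-monoʳ-≤; *-monoˡ-≤-nonNeg; *-monoʳ-≤-nonNeg; *-zeroʳ; *-identityʳ; +-identityʳ; module ≤-Reasoning)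
  open import Data.Rational.Solver using (module +-*-Solver)
  open +-*-Solver using (solve; _:+_; _:*_; _:=_; con)
  open import Relation.Binary.PropositionalEquality using (_≡_; refl; sym; trans; cong; module ≡-Reasoning)

  private
    *-monoˡ-≤ : ∀ {r p q} → 0ℚ ≤ r → p ≤ q → r * p ≤ r * q
    *-monoˡ-≤ {r} 0≤r = *-monoˡ-≤-nonNeg r {{nonNegative 0≤r}}

    *-monoʳ-≤ : ∀ {r p q} → 0ℚ ≤ r → p ≤ q → p * r ≤ q * r
    *-monoʳ-≤ {r} 0≤r = *-monoʳ-≤-nonNeg r {{nonNegative 0≤r}}

    *-nonNeg : ∀ {p q} → 0ℚ ≤ p → 0ℚ ≤ q → 0ℚ ≤ p * q
    *-nonNeg {p} 0≤p 0≤q = ≤-trans (≤-reflexive (sym (*-zeroʳ p))) (*-monoˡ-≤ 0≤p 0≤q)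

    ≤-+-nonNeg : ∀ {p q} → 0ℚ ≤ q → p ≤ p + q
    ≤-+-nonNeg {p} 0≤q = ≤-trans (≤-reflexive (sym (+-identityʳ p))) (+-monoʳ-≤ p 0≤q)

  ^-nonNeg : ∀ {a} → 0ℚ ≤ a → ∀ n → 0ℚ ≤ a ^ℚ n
  ^-nonNeg 0≤a zero = ≤-trans (frac-nonNeg 1 0) (≤-reflexive frac-1)
  ^-nonNeg 0≤a (suc n) = *-nonNeg 0≤a (^-nonNeg 0≤a n)

  ^-mono-≤ : ∀ {a b} → 0ℚ ≤ b → b ≤ a → ∀ n → b ^ℚ n ≤ a ^ℚ n
  ^-mono-≤ 0≤b b≤a zero = ≤-refl
  ^-mono-≤ 0≤b b≤a (suc n) =
    ≤-trans (*-monoʳ-≤ (^-nonNeg 0≤b n) b≤a) (*-monoˡ-≤ (≤-trans 0≤b b≤a) (^-mono-≤ 0≤b b≤a n))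

  ^-suc-+-≤ : ∀ {b c} → 0ℚ ≤ b → 0ℚ ≤ c → ∀ n →
    (b + c) ^ℚ suc n ≤ b ^ℚ suc n + frac (suc n) 0 * c * (b + c) ^ℚ n
  ^-suc-+-≤ {b} {c} 0≤b 0≤c zero = ≤-reflexive (trans
    (solve 2 (λ b c → (b :+ c) :* con 1ℚ := b :* con 1ℚ :+ con 1ℚ :* c :* con 1ℚ) refl b c)
    (cong (λ x → b * 1ℚ + x * c * 1ℚ) (sym frac-1)))
  ^-suc-+-≤ {b} {c} 0≤b 0≤c (suc n) = begin
    a * a ^ℚ suc n
      ≤⟨ *-monoˡ-≤ 0≤a (^-suc-+-≤ 0≤b 0≤c n) ⟩
    a * (bⁿ⁺¹ + K * c * aⁿ)
      ≡⟨ solve 5 (λ b c B K A → (b :+ c) :* (B :+ K :* c :* A) := b :* B :+ c :* B :+ K :* c :* ((b :+ c) :* A)) refl b c bⁿ⁺¹ K aⁿ ⟩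
    b * bⁿ⁺¹ + c * bⁿ⁺¹ + K * c * (a * aⁿ)
      ≤⟨ +-monoˡ-≤ (K * c * (a * aⁿ)) (+-monoʳ-≤ (b * bⁿ⁺¹) (*-monoˡ-≤ 0≤c (^-mono-≤ 0≤b (≤-+-nonNeg 0≤c) (suc n)))) ⟩
    b * bⁿ⁺¹ + c * (a * aⁿ) + K * c * (a * aⁿ)
      ≡⟨ solve 5 (λ b c K X B → b :* B :+ c :* X :+ K :* c :* X := b :* B :+ (K :+ con 1ℚ) :* c :* X) refl b c K (a * aⁿ) bⁿ⁺¹ ⟩
    b * bⁿ⁺¹ + (K + 1ℚ) * c * (a * aⁿ)
      ≡⟨ cong (λ x → b * bⁿ⁺¹ + x * c * (a * aⁿ)) (sym (frac-suc (suc n))) ⟩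
    b * bⁿ⁺¹ + frac (suc (suc n)) 0 * c * (a * aⁿ) ∎
    where
    open ≤-Reasoning
    a = b + c
    0≤a = +-mono-≤ 0≤b 0≤c
    bⁿ⁺¹ = b ^ℚ suc n
    aⁿ = a ^ℚ n
    K = frac (suc n) 0

  evenPowerSum : ℚ → ℕ → ℚ
  evenPowerSum a zero = 0ℚ
  evenPowerSum a (suc n) = evenPowerSum a n + a ^ℚ (2 ℕ.* n)

  evenPowerSum-telescope : ∀ {a e} → a * a + e ≡ 1ℚ → ∀ n → evenPowerSum a n * e + a ^ℚ (2 ℕ.* n) ≡ 1ℚ
  evenPowerSum-telescope {a} {e} a²+e≡1 zero = solve 1 (λ e → con 0ℚ :* e :+ con 1ℚ := con 1ℚ) refl e
  evenPowerSum-telescope {a} {e} a²+e≡1 (suc n) = begin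
    (S + a²ⁿ) * e + a ^ℚ (2 ℕ.* suc n)
      ≡⟨ cong (λ x → (S + a²ⁿ) * e + a ^ℚ x) (*-suc 2 n) ⟩
    (S + a²ⁿ) * e + a * (a * a²ⁿ)
      ≡⟨ solve 4 (λ S p e a → (S :+ p) :* e :+ a :* (a :* p) := S :* e :+ p :* (a :* a :+ e)) refl S a²ⁿ e a ⟩
    S * e + a²ⁿ * (a * a + e)
      ≡⟨ cong (λ x → S * e + a²ⁿ * x) a²+e≡1 ⟩
    S * e + a²ⁿ * 1ℚ
      ≡⟨ cong (λ x → S * e + x) (*-identityʳ a²ⁿ) ⟩
    S * e + a²ⁿ
      ≡⟨ evenPowerSum-telescope a²+e≡1 n ⟩
    1ℚ ∎
    where
    open ≡-Reasoning
    S = evenPowerSum a n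
    a²ⁿ = a ^ℚ (2 ℕ.* n)

  evenPowerSum-*-≤ : ∀ {a e} → 0ℚ ≤ a → a * a + e ≡ 1ℚ → ∀ n → evenPowerSum a n * e ≤ 1ℚ
  evenPowerSum-*-≤ {a} 0≤a a²+e≡1 n =
    ≤-trans (≤-+-nonNeg (^-nonNeg 0≤a (2 ℕ.* n))) (≤-reflexive (evenPowerSum-telescope a²+e≡1 n))

  -- Partial sums of 2 Σ y^(2j+1)/(2j+1) = log ((1 + y)/(1 - y)).
  logSeries : ℚ → ℕ → ℚ
  logSeries y zero = 0ℚ
  logSeries y (suc n) = logSeries y n + frac 2 (2 ℕ.* n) * y ^ℚ suc (2 ℕ.* n)

  logSeries-mono : ∀ {b c} → 0ℚ ≤ b → 0ℚ ≤ c → ∀ n → logSeries b n ≤ logSeries (b + c) n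
  logSeries-mono 0≤b 0≤c zero = ≤-refl
  logSeries-mono 0≤b 0≤c (suc n) = +-mono-≤ (logSeries-mono 0≤b 0≤c n)
    (*-monoˡ-≤ (frac-nonNeg 2 (2 ℕ.* n)) (^-mono-≤ 0≤b (≤-+-nonNeg 0≤c) (suc (2 ℕ.* n))))

  private
    weight-* : ∀ j → frac 2 (2 ℕ.* j) * frac (suc (2 ℕ.* j)) 0 ≡ frac 2 0
    weight-* j = trans (frac-* 2 (2 ℕ.* j) (suc (2 ℕ.* j)) 0) (frac-cong (cross (2 ℕ.* j)))
      where
      cross : ∀ m → 2 ℕ.* suc m ℕ.* 1 ≡ 2 ℕ.* suc (0 ℕ.+ m ℕ.* 1)
      cross = solve-∀

  -- Term by term, (b + c)^(2j+1) - b^(2j+1) ≤ (2j+1) c (b + c)^(2j) and the weight 2/(2j+1) cancels 2j+1.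
  logSeries-+-≤ : ∀ {b c} → 0ℚ ≤ b → 0ℚ ≤ c → ∀ n →
    logSeries (b + c) n ≤ logSeries b n + frac 2 0 * c * evenPowerSum (b + c) n
  logSeries-+-≤ {b} {c} 0≤b 0≤c zero = ≤-reflexive (solve 2 (λ x y → con 0ℚ := con 0ℚ :+ x :* y :* con 0ℚ) refl (frac 2 0) c)
  logSeries-+-≤ {b} {c} 0≤b 0≤c (suc n) = begin
    logSeries a n + w * a ^ℚ suc (2 ℕ.* n)
      ≤⟨ +-mono-≤ (logSeries-+-≤ 0≤b 0≤c n) (*-monoˡ-≤ (frac-nonNeg 2 (2 ℕ.* n)) (^-suc-+-≤ 0≤b 0≤c (2 ℕ.* n))) ⟩
    L + T * S + w * (B + K * c * A)
      ≡⟨ solve 8 (λ L T S w B K c A → L :+ T :* S :+ w :* (B :+ K :* c :* A) := L :+ w :* B :+ (w :* K) :* c :* A :+ T :* S) refl L T S w B K c A ⟩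
    L + w * B + (w * K) * c * A + T * S
      ≡⟨ cong (λ x → L + w * B + x * c * A + T * S) (weight-* n) ⟩
    L + w * B + T * A + T * S
      ≡⟨ solve 4 (λ L T A S → L :+ T :* A :+ T :* S := L :+ T :* (S :+ A)) refl (L + w * B) T A S ⟩
    L + w * B + T * (S + A) ∎
    where
    open ≤-Reasoning
    a = b + c
    w = frac 2 (2 ℕ.* n)
    L = logSeries b n
    T = frac 2 0 * c
    S = evenPowerSum a n
    A = a ^ℚ (2 ℕ.* n)
    B = b ^ℚ suc (2 ℕ.* n)
    K = frac (suc (2 ℕ.* n)) 0

  logSeries-shift : ∀ {b c d e} → 0ℚ ≤ b → 0ℚ ≤ c → 0ℚ ≤ d →
    (b + c) * (b + c) + e ≡ 1ℚ → d * e ≡ frac 2 0 * c → ∀ n → logSeries (b + c) n ≤ logSeries b n + d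
  logSeries-shift {b} {c} {d} {e} 0≤b 0≤c 0≤d a²+e≡1 de≡2c n = begin
    logSeries (b + c) n
      ≤⟨ logSeries-+-≤ 0≤b 0≤c n ⟩
    logSeries b n + frac 2 0 * c * S
      ≡⟨ cong (λ x → logSeries b n + x * S) (sym de≡2c) ⟩
    logSeries b n + d * e * S
      ≡⟨ cong (λ x → logSeries b n + x) (solve 3 (λ d e S → d :* e :* S := d :* (S :* e)) refl d e S) ⟩
    logSeries b n + d * (S * e)
      ≤⟨ +-monoʳ-≤ (logSeries b n) (*-monoˡ-≤ 0≤d (evenPowerSum-*-≤ (+-mono-≤ 0≤b 0≤c) a²+e≡1 n)) ⟩
    logSeries b n + d * 1ℚ
      ≡⟨ cong (λ x → logSeries b n + x) (*-identityʳ d) ⟩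
    logSeries b n + d ∎
    where
    open ≤-Reasoning
    S = evenPowerSum (b + c) n


module LogBounds where

  open Fraction
  open Series
  open import Defs using (_^ℚ_; logY; logPartial)
  open import Data.Nat as ℕ using (ℕ; zero; suc; _+_; _*_; _^_; s≤s; z≤n)
  open import Data.Nat.Properties using (m≤n⇒∃[o]m+o≡n; m+n≤o⇒m≤o; m^n>0; ≤ᵇ⇒≤) renaming (≤-reflexive to ≤-reflexive′)
  open import Data.Nat.Tactic.RingSolver using (solve-∀)
  open import Data.Rational using (ℚ; _≤_; 0ℚ; 1ℚ) renaming (_+_ to _+ℚ_; _*_ to _*ℚ_)
  open import Data.Rational.Properties using (+-monoˡ-≤; +-monoʳ-≤; +-identityˡ; module ≤-Reasoning)
  open import Data.Rational.Solver using (module +-*-Solver)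
  open +-*-Solver using (solve; _:+_; _:*_; _:=_; con)
  open import Data.Product using (_,_)
  open import Data.Unit using (tt)
  open import Relation.Binary.PropositionalEquality using (_≡_; refl; sym; trans; cong; cong₂; subst)

  logPartial≡logSeries : ∀ x n → logPartial x n ≡ logSeries (logY x) n
  logPartial≡logSeries x zero = refl
  logPartial≡logSeries x (suc n) =
    cong₂ (λ L w → L +ℚ w *ℚ (logY x ^ℚ suc (2 * n))) (logPartial≡logSeries x n) (+/suc≡frac 2 (2 * n))

  logSeries-0 : ∀ n → logSeries 0ℚ n ≡ 0ℚ
  logSeries-0 zero = refl
  logSeries-0 (suc n) = trans (cong (λ L → L +ℚ frac 2 (2 * n) *ℚ (0ℚ *ℚ 0ℚ ^ℚ (2 * n))) (logSeries-0 n))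
    (solve 2 (λ w p → con 0ℚ :+ w :* (con 0ℚ :* p) := con 0ℚ) refl (frac 2 (2 * n)) (0ℚ ^ℚ (2 * n)))

  logY-suc : ∀ s → logY (suc s) ≡ frac s (suc s)
  logY-suc s = +/suc≡frac s (suc s)

  logY-nonNeg : ∀ s → 0ℚ ≤ logY (suc s)
  logY-nonNeg s = subst (0ℚ ≤_) (sym (logY-suc s)) (frac-nonNeg s (suc s))

  -- For x = 1 + s and z = x + d these are logY z − logY x, 1 − (logY z)² and (z − x)(z + 1)/(z (x + 1)).
  logY-gap : ℕ → ℕ → ℚ
  logY-gap s d = frac (2 * d) (suc (s + d) ⊗ suc s)

  logY-defect : ℕ → ℕ → ℚ
  logY-defect s d = frac (4 * suc (s + d)) (suc (s + d) ⊗ suc (s + d))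

  step-bound : ℕ → ℕ → ℚ
  step-bound s d = frac (d * (2 + s + d)) ((s + d) ⊗ suc s)

  logY-+-gap : ∀ s d → logY (suc s + d) ≡ logY (suc s) +ℚ logY-gap s d
  logY-+-gap s d = sym (trans (cong (_+ℚ logY-gap s d) (logY-suc s))
    (trans (frac-+ s (suc s) (2 * d) (suc (s + d) ⊗ suc s)) (trans (frac-cong (cross s d)) (sym (logY-suc (s + d))))))
    where
    cross : ∀ s d → (s * ((2 + s + d) * (2 + s)) + 2 * d * (2 + s)) * (2 + s + d)
                  ≡ (s + d) * ((2 + s) * ((2 + s + d) * (2 + s)))
    cross = solve-∀

  logY²+defect : ∀ s d → logY (suc s + d) *ℚ logY (suc s + d) +ℚ logY-defect s d ≡ 1ℚ
  logY²+defect s d = trans (cong (λ y → y *ℚ y +ℚ logY-defect s d) (logY-suc (s + d)))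
    (trans (cong (_+ℚ logY-defect s d) (frac-* (s + d) (suc (s + d)) (s + d) (suc (s + d))))
    (trans (frac-+ _ _ _ _) (trans (frac-cong (cross s d)) frac-1)))
    where
    cross : ∀ s d → ((s + d) * (s + d) * ((2 + s + d) * (2 + s + d)) + 4 * (1 + s + d) * ((2 + s + d) * (2 + s + d))) * 1
                  ≡ 1 * (((2 + s + d) * (2 + s + d)) * ((2 + s + d) * (2 + s + d)))
    cross = solve-∀

  step-bound-*-defect : ∀ s d → step-bound s d *ℚ logY-defect s d ≡ frac 2 0 *ℚ logY-gap s d
  step-bound-*-defect s d = trans (frac-* _ _ _ _) (trans (frac-cong (cross s d)) (sym (frac-* _ _ _ _)))
    where
    cross : ∀ s d → d * (2 + s + d) * (4 * (1 + s + d)) * (1 * ((2 + s + d) * (2 + s)))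
                  ≡ 2 * (2 * d) * (((1 + s + d) * (2 + s)) * ((2 + s + d) * (2 + s + d)))
    cross = solve-∀

  logPartial-step : ∀ s d n → logPartial (suc s + d) n ≤ logPartial (suc s) n +ℚ step-bound s d
  logPartial-step s d n = begin
    logPartial (suc s + d) n                   ≡⟨ logPartial≡logSeries (suc s + d) n ⟩
    logSeries (logY (suc s + d)) n             ≡⟨ cong (λ y → logSeries y n) (logY-+-gap s d) ⟩
    logSeries (logY (suc s) +ℚ logY-gap s d) n ≤⟨ logSeries-shift (logY-nonNeg s) (frac-nonNeg _ _) (frac-nonNeg _ _)
                                                     (trans (cong (λ y → y *ℚ y +ℚ logY-defect s d) (sym (logY-+-gap s d))) (logY²+defect s d))
                                                     (step-bound-*-defect s d) n ⟩
    logSeries (logY (suc s)) n +ℚ step-bound s d ≡⟨ cong (_+ℚ step-bound s d) (sym (logPartial≡logSeries (suc s) n)) ⟩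
    logPartial (suc s) n +ℚ step-bound s d ∎
    where open ≤-Reasoning

  logPartial-mono : ∀ {x z} → 1 ℕ.≤ x → x ℕ.≤ z → ∀ n → logPartial x n ≤ logPartial z n
  logPartial-mono {suc s} (s≤s z≤n) x≤z n with d , refl ← m≤n⇒∃[o]m+o≡n x≤z = begin
    logPartial (suc s) n                       ≡⟨ logPartial≡logSeries (suc s) n ⟩
    logSeries (logY (suc s)) n                 ≤⟨ logSeries-mono (logY-nonNeg s) (frac-nonNeg _ _) n ⟩
    logSeries (logY (suc s) +ℚ logY-gap s d) n ≡⟨ cong (λ y → logSeries y n) (sym (logY-+-gap s d)) ⟩
    logSeries (logY (suc s + d)) n             ≡⟨ logPartial≡logSeries (suc s + d) n ⟨
    logPartial (suc s + d) n ∎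
    where open ≤-Reasoning

  logPartial-1 : ∀ n → logPartial 1 n ≡ 0ℚ
  logPartial-1 n = trans (logPartial≡logSeries 1 n)
    (trans (cong (λ y → logSeries y n) (trans (logY-suc 0) (frac-0 1))) (logSeries-0 n))

  logPartial-3-≤ : ∀ n → logPartial 3 n ≤ frac 43 35
  logPartial-3-≤ n = begin
    logPartial 3 n                         ≤⟨ logPartial-step 1 1 n ⟩
    logPartial 2 n +ℚ frac 4 8             ≤⟨ +-monoˡ-≤ (frac 4 8) (logPartial-step 0 1 n) ⟩
    logPartial 1 n +ℚ frac 3 3 +ℚ frac 4 8 ≡⟨ cong (λ L → L +ℚ frac 3 3 +ℚ frac 4 8) (logPartial-1 n) ⟩
    0ℚ +ℚ frac 3 3 +ℚ frac 4 8             ≡⟨ cong (_+ℚ frac 4 8) (+-identityˡ (frac 3 3)) ⟩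
    frac 3 3 +ℚ frac 4 8                   ≡⟨ frac-+ 3 3 4 8 ⟩
    frac 43 35                             ∎
    where open ≤-Reasoning

  logPartial-4-≤ : ∀ n → logPartial 4 n ≤ frac 151 99
  logPartial-4-≤ n = begin
    logPartial 4 n               ≤⟨ logPartial-step 2 1 n ⟩
    logPartial 3 n +ℚ frac 5 15  ≤⟨ +-monoˡ-≤ (frac 5 15) (logPartial-3-≤ n) ⟩
    frac 43 35 +ℚ frac 5 15      ≡⟨ frac-+ 43 35 5 15 ⟩
    frac 868 575                 ≤⟨ frac-mono-≤ (≤ᵇ⇒≤ _ _ tt) ⟩
    frac 151 99                  ∎
    where open ≤-Reasoning

  logPartial-double : ∀ {x} → 1 ℕ.≤ x → ∀ n → logPartial (2 * x) n ≤ logPartial x n +ℚ 1ℚ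
  logPartial-double {suc s} _ n = begin
    logPartial (2 * suc s) n                ≡⟨ cong (λ z → logPartial z n) (double s) ⟩
    logPartial (suc s + suc s) n            ≤⟨ logPartial-step s (suc s) n ⟩
    logPartial (suc s) n +ℚ step-bound s (suc s) ≤⟨ +-monoʳ-≤ (logPartial (suc s) n) (frac-mono-≤ (m+n≤o⇒m≤o _ (≤-reflexive′ (cross s)))) ⟩
    logPartial (suc s) n +ℚ frac 1 0        ≡⟨ cong (logPartial (suc s) n +ℚ_) frac-1 ⟩
    logPartial (suc s) n +ℚ 1ℚ              ∎
    where
    open ≤-Reasoning
    double : ∀ s → 2 * suc s ≡ suc s + suc s
    double = solve-∀
    cross : ∀ s → suc s * (2 + s + suc s) * 1 + suc s ≡ 1 * ((1 + s + suc s) * (2 + s))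
    cross = solve-∀

  logPartial-2^ : ∀ j n → logPartial (2 ^ (2 + j)) n ≤ frac (100 * suc j + 51) 99
  logPartial-2^ zero n = logPartial-4-≤ n
  logPartial-2^ (suc j) n = begin
    logPartial (2 * 2 ^ (2 + j)) n             ≤⟨ logPartial-double (m^n>0 2 (2 + j)) n ⟩
    logPartial (2 ^ (2 + j)) n +ℚ 1ℚ           ≤⟨ +-monoˡ-≤ 1ℚ (logPartial-2^ j n) ⟩
    frac (100 * suc j + 51) 99 +ℚ 1ℚ          ≡⟨ cong (frac (100 * suc j + 51) 99 +ℚ_) frac-1 ⟨
    frac (100 * suc j + 51) 99 +ℚ frac 1 0     ≡⟨ frac-+ _ 99 1 0 ⟩
    frac ((100 * suc j + 51) * 1 + 1 * 100) (99 ⊗ 0) ≡⟨ frac-cong (cross j) ⟩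
    frac (100 * suc (suc j) + 51) 99           ∎
    where
    open ≤-Reasoning
    cross : ∀ j → ((100 * suc j + 51) * 1 + 1 * 100) * 100 ≡ (100 * suc (suc j) + 51) * 100
    cross = solve-∀


module Arithmetic where

  open import Data.Nat as ℕ using (zero; suc; _+_; _*_; _^_; _≤_; _<_; _∸_; s≤s; s≤s⁻¹; z≤n; NonZero)
  open import Data.Nat.Properties
  open import Data.Nat.DivMod using (m≡m%n+[m/n]*n; m%n<n)
  open import Data.Nat.Tactic.RingSolver using (solve-∀)
  open import Data.Product using (∃; _×_; _,_)
  open import Data.Sum using (inj₁; inj₂)
  open import Relation.Binary.PropositionalEquality using (_≡_; refl; sym; trans; cong; subst)

  2*m*n≤m*m+n*n : ∀ m n → 2 * m * n ≤ m * m + n * n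
  2*m*n≤m*m+n*n m n with ≤-total m n
  ... | inj₁ m≤n with d , refl ← m≤n⇒∃[o]m+o≡n m≤n = m+n≤o⇒m≤o _ (≤-reflexive (square m d))
    where
    square : ∀ m d → 2 * m * (m + d) + d * d ≡ m * m + (m + d) * (m + d)
    square = solve-∀
  ... | inj₂ n≤m with d , refl ← m≤n⇒∃[o]m+o≡n n≤m = m+n≤o⇒m≤o _ (≤-reflexive (square n d))
    where
    square : ∀ n d → 2 * (n + d) * n + d * d ≡ (n + d) * (n + d) + n * n
    square = solve-∀

  -- r blocks of size q + 1 and h of size q: m = r + h blocks, k = r (q + 1) + h q cells, P = r (q + 1)² + h q² pairs.
  balanced-identity : ∀ r h q →
    (r + h) * (r * (suc q * suc q) + h * (q * q)) + r * r ≡ (r * suc q + h * q) * (r * suc q + h * q) + (r + h) * r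
  balanced-identity = solve-∀

  -- With m P + r² = k² + m r, AM-GM 4 m r ≤ (2r)² + m² gives P ≤ k²/m + m/4.
  pairs-bound : ∀ m k P r → m * P + r * r ≡ k * k + m * r → 4 * m * P ≤ 4 * (k * k) + m * m
  pairs-bound m k P r identity = +-cancelʳ-≤ (4 * (r * r)) _ _ (begin
    4 * m * P + 4 * (r * r)         ≡⟨ scaled m P r k identity ⟩
    4 * (k * k) + 2 * (2 * r) * m   ≤⟨ +-monoʳ-≤ (4 * (k * k)) (2*m*n≤m*m+n*n (2 * r) m) ⟩
    4 * (k * k) + (2 * r * (2 * r) + m * m) ≡⟨ regroup k r m ⟩
    4 * (k * k) + m * m + 4 * (r * r) ∎)
    where
    open ≤-Reasoning
    scaled : ∀ m P r k → m * P + r * r ≡ k * k + m * r → 4 * m * P + 4 * (r * r) ≡ 4 * (k * k) + 2 * (2 * r) * m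
    scaled m P r k eq = trans (lhs m P r) (trans (cong (4 *_) eq) (rhs k m r))
      where
      lhs : ∀ m P r → 4 * m * P + 4 * (r * r) ≡ 4 * (m * P + r * r)
      lhs = solve-∀
      rhs : ∀ k m r → 4 * (k * k + m * r) ≡ 4 * (k * k) + 2 * (2 * r) * m
      rhs = solve-∀
    regroup : ∀ k r m → 4 * (k * k) + (2 * r * (2 * r) + m * m) ≡ 4 * (k * k) + m * m + 4 * (r * r)
    regroup = solve-∀

  -- Cleared of denominators: Q (m + 0.51) ≤ 1.4 k².
  pairs-fit-≥2 : ∀ {m k P Q} → 2 ≤ m → m < k → 4 * m * P ≤ 4 * (k * k) + m * m → Q < P →
    Q * (100 * m + 51) * 5 ≤ 7 * k * k * 100
  pairs-fit-≥2 {m} {k} {P} {Q} 2≤m m<k bound Q<P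
    with a , refl ← m≤n⇒∃[o]m+o≡n 2≤m | b , refl ← m≤n⇒∃[o]m+o≡n m<k =
    ≤-trans (*-monoˡ-≤ 5 per-weight) (≤-reflexive (rescale k))
    where
    open ≤-Reasoning
    t = 100 * m + 51
    rescale : ∀ k → 140 * (k * k) * 5 ≡ 7 * k * k * 100
    rescale = solve-∀
    certificate : ∀ a b →
      (4 * ((3 + a + b) * (3 + a + b)) + (2 + a) * (2 + a)) * (100 * (2 + a) + 51)
        + (2048 + 2536 * a + 696 * b + 825 * a * a + 1192 * a * b + 116 * b * b
           + 60 * a * a * a + 320 * a * a * b + 160 * a * b * b)
      ≡ 4 * (2 + a) * (140 * ((3 + a + b) * (3 + a + b))) + 4 * (2 + a) * (100 * (2 + a) + 51)
    certificate = solve-∀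
    split : ∀ c Q t → c * suc Q * t ≡ c * (Q * t) + c * t
    split = solve-∀
    per-weight : Q * t ≤ 140 * (k * k)
    per-weight = *-cancelˡ-≤ (4 * m) (+-cancelʳ-≤ (4 * m * t) _ _ (begin
      4 * m * (Q * t) + 4 * m * t             ≡⟨ split (4 * m) Q t ⟨
      4 * m * suc Q * t                       ≤⟨ *-monoˡ-≤ t (≤-trans (*-monoʳ-≤ (4 * m) Q<P) bound) ⟩
      (4 * (k * k) + m * m) * t               ≤⟨ m+n≤o⇒m≤o _ (≤-reflexive (certificate a b)) ⟩
      4 * m * (140 * (k * k)) + 4 * m * t     ∎))

  -- Cleared of denominators: Q · 1.2 ≤ 1.4 k².
  pairs-fit-1 : ∀ {k P Q} → 4 * 1 * P ≤ 4 * (k * k) + 1 * 1 → Q < P → Q * 6 * 5 ≤ 7 * k * k * 5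
  pairs-fit-1 {k} {P} {Q} bound Q<P = *-monoˡ-≤ 5 (begin
    Q * 6         ≤⟨ *-monoˡ-≤ 6 (<⇒≤ (<-≤-trans Q<P P≤k²)) ⟩
    k * k * 6     ≤⟨ m≤m+n (k * k * 6) (k * k) ⟩
    k * k * 6 + k * k ≡⟨ seven k ⟩
    7 * k * k     ∎)
    where
    open ≤-Reasoning
    seven : ∀ k → k * k * 6 + k * k ≡ 7 * k * k
    seven = solve-∀
    room : ∀ K → suc (4 * K + 1 * 1) + 2 ≡ 4 * suc K
    room = solve-∀
    P≤k² : P ≤ k * k
    P≤k² = s≤s⁻¹ (*-cancelˡ-< 4 P (suc (k * k)) (≤-<-trans bound (m+n≤o⇒m≤o _ (≤-reflexive (room (k * k))))))

  pow2-bracket : ∀ x → 1 ≤ x → ∃ λ m → 2 ^ m ≤ x × x < 2 ^ suc m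
  pow2-bracket (suc zero) _ = 0 , s≤s z≤n , s≤s (s≤s z≤n)
  pow2-bracket (suc (suc x)) _ with pow2-bracket (suc x) (s≤s z≤n)
  ... | m , lo , hi with m≤n⇒m<n∨m≡n hi
  ...   | inj₁ lt = m , m≤n⇒m≤1+n lo , lt
  ...   | inj₂ eq = suc m , ≤-reflexive (sym eq) ,
          subst (_< 2 ^ suc (suc m)) (sym eq) (^-monoʳ-< 2 (s≤s (s≤s z≤n)) (n<1+n (suc m)))

  exponent-positive : ∀ {x m} → 2 ≤ x → x < 2 ^ suc m → 1 ≤ m
  exponent-positive {m = zero} (s≤s (s≤s _)) (s≤s (s≤s ()))
  exponent-positive {m = suc m} _ _ = s≤s z≤n

  balanced-split : ∀ k m .{{_ : NonZero m}} → ∃ λ r → ∃ λ h → ∃ λ q → r + h ≡ m × k ≡ r * suc q + h * q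
  balanced-split k m = r , m ∸ r , q , r+h≡m ,
    trans (m≡m%n+[m/n]*n k m) (trans (cong (λ m → r + q * m) (sym r+h≡m)) (regroup r (m ∸ r) q))
    where
    r = k ℕ.% m
    q = k ℕ./ m
    r+h≡m : r + (m ∸ r) ≡ m
    r+h≡m = m+[n∸m]≡n (<⇒≤ (m%n<n k m))
    regroup : ∀ r h q → r + q * (r + h) ≡ r * suc q + h * q
    regroup = solve-∀


module BlockConstruction where

  open import Defs using (Choosable; Kcomplete)
  open import Data.Nat using (ℕ; zero; suc; _+_; _*_; _^_; _≤_; z≤n; NonZero; >-nonZero; >-nonZero⁻¹)
  open import Data.Nat.Properties using (m≤n⇒∃[o]m+o≡n; m^n≢0; <-≤-trans; +-mono-≤; *-monoʳ-≤; m≤m*n)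
  open import Data.Fin using (Fin; zero; splitAt; join; _↑ˡ_; finToFun; funToFin)
  open import Data.Fin.Patterns using (0F; 1F)
  open import Data.Fin.Properties using (all?; any?; ¬∀⟶∃¬; _≟_; splitAt-join; splitAt-↑ˡ; finToFun-funToFin; +↔⊎; *↔×)
  open import Data.Product using (Σ; ∃; _×_; _,_; proj₁; proj₂; map₂)
  open import Data.Product.Function.NonDependent.Propositional using (_×-↔_)
  open import Data.Sum using (_⊎_; inj₁; inj₂; [_,_]′)
  open import Data.Sum.Function.Propositional using (_⊎-↔_)
  open import Function using (_∘_; id; const)
  open import Function.Bundles using (_↔_; Inverse; Injection)
  open import Function.Definitions using (Injective; StrictlySurjective)
  open import Function.Properties.Inverse using (↔-refl; ↔-sym; ↔-trans; ↔⇒↣)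
  open import Function.Related.TypeIsomorphisms using (Σ-distribʳ-⊎)
  open import Relation.Nullary using (¬_; yes; no)
  open import Relation.Binary.PropositionalEquality using (_≡_; _≢_; _≗_; refl; sym; trans; cong; cong₂; subst₂)

  endpoint : {A : Set} → A × A → Fin 2 → A
  endpoint (u , v) 0F = u
  endpoint (u , v) 1F = v

  ≢0F⇒≡1F : {x : Fin 2} → x ≢ 0F → x ≡ 1F
  ≢0F⇒≡1F {0F} x≢0 with () ← x≢0 refl
  ≢0F⇒≡1F {1F} x≢0 = refl

  -- If some u is the 0F-endpoint of no pair choosing 0F, the pairs (u , v) cover every v from 1F.
  one-side-covered : ∀ {s} (choice : Fin s × Fin s → Fin 2) →
    ∃ λ x → ∀ u → ∃ λ e → choice e ≡ x × endpoint e x ≡ u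
  one-side-covered {s} choice with all? (λ u → any? (λ v → choice (u , v) ≟ 0F))
  ... | yes rows = 0F , λ u → (u , proj₁ (rows u)) , proj₂ (rows u) , refl
  ... | no ¬rows with u , ¬row ← ¬∀⟶∃¬ s _ (λ u → any? (λ v → choice (u , v) ≟ 0F)) ¬rows =
    1F , λ v → (u , v) , ≢0F⇒≡1F (λ chosen → ¬row (v , chosen)) , refl

  module _ {Block : Set} (size : Block → ℕ) where

    Cell : Set
    Cell = Σ Block (Fin ∘ size)

    Pair : Set
    Pair = Σ Block (λ b → Fin (size b) × Fin (size b))

    pairColours : Pair → Fin 2 → Cell × Fin 2
    pairColours t x = map₂ (λ e → endpoint e x) t , x

    cellColours : ∀ {k} → (Fin k → Cell) → (Block → Fin 2) → Fin k → Cell × Fin 2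
    cellColours position σ i = position i , σ (proj₁ (position i))

    sides-covered : ∀ {nA} (pair : Fin nA → Pair) → StrictlySurjective _≡_ pair → (cA : Fin nA → Fin 2) →
      ∃ λ (side : Block → Fin 2) → ∀ b u → ∃ λ a → pairColours (pair a) (cA a) ≡ ((b , u) , side b)
    sides-covered {nA} pair pair-onto cA = side , covered
      where
      vertex : Pair → Fin nA
      vertex t = proj₁ (pair-onto t)

      block-choice : ∀ b → Fin (size b) × Fin (size b) → Fin 2
      block-choice b e = cA (vertex (b , e))

      side : Block → Fin 2
      side b = proj₁ (one-side-covered (block-choice b))

      covered : ∀ b u → ∃ λ a → pairColours (pair a) (cA a) ≡ ((b , u) , side b)
      covered b u with e , chosen , end ← proj₂ (one-side-covered (block-choice b)) u =
        vertex (b , e) , trans (cong₂ pairColours (proj₂ (pair-onto (b , e))) chosen) (cong (λ w → (b , w) , side b) end)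

    ¬Choosable-blocks : ∀ {k nA nB} →
      (position : Fin k → Cell) → Injective _≡_ _≡_ position →
      (pair : Fin nA → Pair) → StrictlySurjective _≡_ pair →
      (profile : Fin nB → Block → Fin 2) → StrictlySurjective _≗_ profile →
      ¬ Choosable nA nB (Kcomplete nA nB) 2 k
    ¬Choosable-blocks {k} {nA} {nB} position position-inj pair pair-onto profile profile-onto choosable
      with cA , cB , proper ← choosable (Cell × Fin 2) (pairColours ∘ pair) (cellColours position ∘ profile)
                                (λ _ → cong proj₂) (λ _ → position-inj ∘ cong proj₁)
      with side , covered ← sides-covered pair pair-onto cA
      with a₀ , a₀-profile ← profile-onto side
      with b , u ← position (cB a₀) in position≡
      with a , a-colour ← covered b u =
      proper a a₀ _ (trans a-colour (sym (cong₂ _,_ position≡ (trans (cong (profile a₀ ∘ proj₁) position≡) (a₀-profile b)))))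

  module Balanced (r h q : ℕ) where

    size : Fin r ⊎ Fin h → ℕ
    size (inj₁ _) = suc q
    size (inj₂ _) = q

    cells : Fin (r * suc q + h * q) ↔ Cell size
    cells = ↔-trans +↔⊎ (↔-trans (*↔× ⊎-↔ *↔×) (↔-sym Σ-distribʳ-⊎))

    pairs : Fin (r * (suc q * suc q) + h * (q * q)) ↔ Pair size
    pairs = ↔-trans +↔⊎ (↔-trans (squares ⊎-↔ squares) (↔-sym Σ-distribʳ-⊎))
      where
      squares : ∀ {n s} → Fin (n * (s * s)) ↔ (Fin n × (Fin s × Fin s))
      squares = ↔-trans *↔× (↔-refl ×-↔ *↔×)

    profile : Fin (2 ^ (r + h)) → Fin r ⊎ Fin h → Fin 2
    profile a = finToFun a ∘ join r h

    profile-onto : StrictlySurjective _≗_ profile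
    profile-onto σ = funToFin (σ ∘ splitAt r) , λ b →
      trans (finToFun-funToFin (σ ∘ splitAt r) (join r h b)) (cong σ (splitAt-join r h b))

    ¬Choosable :
      ¬ Choosable (r * (suc q * suc q) + h * (q * q)) (2 ^ (r + h)) (Kcomplete _ _) 2 (r * suc q + h * q)
    ¬Choosable = ¬Choosable-blocks size
      (Inverse.to cells) (Injection.injective (↔⇒↣ cells))
      (Inverse.to pairs) (λ t → Inverse.from pairs t , Inverse.strictlyInverseˡ pairs t)
      profile profile-onto

  retract : ∀ m d → Fin (suc m + d) → Fin (suc m)
  retract m d i = [ id , const zero ]′ (splitAt (suc m) i)

  retract-↑ˡ : ∀ {m} d (i : Fin (suc m)) → retract m d (i ↑ˡ d) ≡ i
  retract-↑ˡ {m} d i = cong [ id , const zero ]′ (splitAt-↑ˡ (suc m) i d)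

  Choosable-restrict : ∀ {m n d e kA kB} →
    Choosable (suc m + d) (suc n + e) (Kcomplete _ _) kA kB →
    Choosable (suc m) (suc n) (Kcomplete _ _) kA kB
  Choosable-restrict {m} {n} {d} {e} choosable C LA LB LA-inj LB-inj
    with cA , cB , proper ← choosable C (LA ∘ retract m d) (LB ∘ retract n e) (LA-inj ∘ retract m d) (LB-inj ∘ retract n e) =
    cA ∘ (_↑ˡ d) , cB ∘ (_↑ˡ e) , λ a b edge →
      subst₂ (λ a′ b′ → LA a′ (cA (a ↑ˡ d)) ≢ LB b′ (cB (b ↑ˡ e))) (retract-↑ˡ d a) (retract-↑ˡ e b)
        (proper (a ↑ˡ d) (b ↑ˡ e) edge)

  ¬Choosable-mono : ∀ {m m′ n n′ kA kB} → .{{NonZero m}} → .{{NonZero n}} → m ≤ m′ → n ≤ n′ →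
    ¬ Choosable m n (Kcomplete m n) kA kB → ¬ Choosable m′ n′ (Kcomplete m′ n′) kA kB
  ¬Choosable-mono {suc m} {n = suc n} m≤m′ n≤n′ ¬choosable
    with d , refl ← m≤n⇒∃[o]m+o≡n m≤m′ | e , refl ← m≤n⇒∃[o]m+o≡n n≤n′ =
    ¬choosable ∘ Choosable-restrict

  ¬Choosable-if-fits : ∀ {k ΔA ΔB} r h q → .{{NonZero k}} → k ≡ r * suc q + h * q →
    r * (suc q * suc q) + h * (q * q) ≤ ΔB → 2 ^ (r + h) ≤ ΔA → ¬ Choosable ΔB ΔA (Kcomplete ΔB ΔA) 2 k
  ¬Choosable-if-fits {k} r h q refl pairs≤ΔB 2^m≤ΔA =
    ¬Choosable-mono {{>-nonZero (<-≤-trans (>-nonZero⁻¹ k) cells≤pairs)}} {{m^n≢0 2 (r + h)}} pairs≤ΔB 2^m≤ΔA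
      (Balanced.¬Choosable r h q)
    where
    n≤n*n : ∀ n → n ≤ n * n
    n≤n*n zero = z≤n
    n≤n*n (suc n) = m≤m*n (suc n) (suc n)
    cells≤pairs : r * suc q + h * q ≤ r * (suc q * suc q) + h * (q * q)
    cells≤pairs = +-mono-≤ (*-monoʳ-≤ r (n≤n*n (suc q))) (*-monoʳ-≤ h (n≤n*n q))

open import Defs
open import Data.Nat using (ℕ; _≥_; _*_; NonZero)
open import Data.Integer using (+_)
open import Data.Rational using (_/_)
open import Relation.Nullary using (¬_)

open Fraction
open LogBounds
open Arithmetic
open BlockConstruction using (¬Choosable-if-fits)
import Data.Nat as ℕ
open import Data.Nat using (zero; suc; _≤_; _<_; s≤s; s≤s⁻¹; z≤n; >-nonZero; >-nonZero⁻¹)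
open import Data.Nat.Properties using (≤-trans; <⇒≤; ≤⇒≯; <⇒≱; ≮⇒≥; ≰⇒>; ^-monoʳ-≤; *-identityʳ; *-zeroʳ; ≤ᵇ⇒≤; _≤?_)
import Data.Rational as ℚ
import Data.Rational.Properties as ℚ
open import Data.Product using (_,_)
open import Data.Unit using (tt)
open import Relation.Nullary using (yes; no; contradiction)
open import Relation.Binary.PropositionalEquality using (refl; sym; trans; cong; subst)

log-bound⇒< : ∀ {c ΔB L u d} → (+ c) / 5 ℚ.< (+ ΔB / 1) ℚ.* L → L ℚ.≤ frac u d → c ℕ.* suc d < ΔB ℕ.* u ℕ.* 5
log-bound⇒< {c} {ΔB} {L} {u} {d} c<ΔBL L≤u = ≰⇒> λ ΔBu≤c → ℚ.<-irrefl refl (ℚ.<-≤-trans c<ΔBL (begin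
  (+ ΔB / 1) ℚ.* L       ≡⟨ cong (ℚ._* L) (+/suc≡frac ΔB 0) ⟩
  frac ΔB 0 ℚ.* L        ≤⟨ ℚ.*-monoˡ-≤-nonNeg (frac ΔB 0) {{ℚ.nonNegative (frac-nonNeg ΔB 0)}} L≤u ⟩
  frac ΔB 0 ℚ.* frac u d ≡⟨ frac-*ˡ ΔB u d ⟩
  frac (ΔB ℕ.* u) d      ≤⟨ frac-mono-≤ ΔBu≤c ⟩
  frac c 4               ≡⟨ +/suc≡frac c 4 ⟨
  (+ c) / 5              ∎))
  where open ℚ.≤-Reasoning

log-hypothesis⇒2≤ : ∀ {c ΔA ΔB n} → 1 ≤ ΔA → (+ c) / 5 ℚ.< (+ ΔB / 1) ℚ.* logPartial ΔA n → 2 ≤ ΔA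
log-hypothesis⇒2≤ {c} {suc zero} {ΔB} {n} _ hyp = contradiction (log-bound⇒< {c} {ΔB} hyp log1≤0) (≤⇒≯ ΔB*0≤c)
  where
  log1≤0 : logPartial 1 n ℚ.≤ frac 0 0
  log1≤0 = ℚ.≤-reflexive (trans (logPartial-1 n) (sym (frac-0 0)))
  ΔB*0≤c : ΔB ℕ.* 0 ℕ.* 5 ≤ c ℕ.* 1
  ΔB*0≤c = subst (λ z → z ℕ.* 5 ≤ c ℕ.* 1) (sym (*-zeroʳ ΔB)) z≤n
log-hypothesis⇒2≤ {ΔA = suc (suc _)} _ _ = s≤s (s≤s z≤n)

pairs-fit : ∀ {k m ΔA ΔB P n} → 1 ≤ m → m < k → 1 ≤ ΔA → ΔA < 2 ℕ.^ suc m →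
  4 * m * P ≤ 4 * (k * k) ℕ.+ m * m → (+ (7 * k * k)) / 5 ℚ.< (+ ΔB / 1) ℚ.* logPartial ΔA n → P ≤ ΔB
pairs-fit {k} {m = 1} {ΔA} {ΔB} {n = n} _ m<k 1≤ΔA ΔA<4 pairs-bound hyp = ≮⇒≥ λ ΔB<P →
  <⇒≱ (log-bound⇒< {7 * k * k} {ΔB} hyp log≤) (pairs-fit-1 {k} pairs-bound ΔB<P)
  where
  log≤ : logPartial ΔA n ℚ.≤ frac 6 4
  log≤ = ℚ.≤-trans (logPartial-mono 1≤ΔA (s≤s⁻¹ ΔA<4) n) (ℚ.≤-trans (logPartial-3-≤ n) (frac-mono-≤ (≤ᵇ⇒≤ _ _ tt)))
pairs-fit {k} {m = suc (suc a)} {ΔA} {ΔB} {n = n} _ m<k 1≤ΔA ΔA<2^m+1 pairs-bound hyp = ≮⇒≥ λ ΔB<P →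
  <⇒≱ (log-bound⇒< {7 * k * k} {ΔB} hyp log≤) (pairs-fit-≥2 (s≤s (s≤s z≤n)) m<k pairs-bound ΔB<P)
  where
  log≤ : logPartial ΔA n ℚ.≤ frac (100 * suc (suc a) ℕ.+ 51) 99
  log≤ = ℚ.≤-trans (logPartial-mono 1≤ΔA (<⇒≤ ΔA<2^m+1) n) (logPartial-2^ (suc a) n)

proposition2p5 : (k ΔA ΔB : ℕ) → NonZero k → NonZero ΔA → NonZero ΔB →
    ΔB ≥ k →
    ((+ (7 * k * k)) / 5) < ΔB ·log ΔA →
    ¬ Choosable ΔB ΔA (Kcomplete ΔB ΔA) 2 k
proposition2p5 k ΔA ΔB k≢0 ΔA≢0 _ k≤ΔB (n , hyp)
  with 1≤ΔA ← >-nonZero⁻¹ ΔA {{ΔA≢0}}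
  with m , 2^m≤ΔA , ΔA<2^m+1 ← pow2-bracket ΔA 1≤ΔA
  with k ≤? m
... | yes k≤m = ¬Choosable-if-fits 0 k 1 {{k≢0}} (sym (*-identityʳ k))
      (subst (_≤ ΔB) (sym (*-identityʳ k)) k≤ΔB) (≤-trans (^-monoʳ-≤ 2 k≤m) 2^m≤ΔA)
... | no k≰m
  with 1≤m ← exponent-positive (log-hypothesis⇒2≤ {7 * k * k} {ΔA} {ΔB} {n} 1≤ΔA hyp) ΔA<2^m+1
  with r , h , q , refl , refl ← balanced-split k m {{>-nonZero 1≤m}} =
    ¬Choosable-if-fits r h q {{k≢0}} refl
      (pairs-fit {n = n} 1≤m (≰⇒> k≰m) 1≤ΔA ΔA<2^m+1 (pairs-bound (r ℕ.+ h) k _ r (balanced-identity r h q)) hyp)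
      2^m≤ΔA
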